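{- Let $G,H$ be finite digraphs, $k\geq1$ and $n<\omega$. If $\forall$ has a strategy for winning by round $n$ in the strong Seurat game $\hat{\mathbf{G}}^k(G,H)$, then $\forall$ has a strategy for winning by round $n+1$ in the Seurat game $\mathbf{G}^{k+1}(G,H)$.
   Context: Digraphs: finite vertex set with edge relation (loops allowed, no multiple edges), identified with their vertex sets. Seurat game $\mathbf{G}^k(G,H)$: two players $\forall,\exists$, a set $\mathbf{Col}$ of $k$ colours. A position is a pair of functions $g:\mathbf{Col}\to\wp(G)$, $h:\mathbf{Col}\to\wp(H)$, initially all empty. Rounds are numbered $0,1,2,\ldots$ ($\omega$ rounds). In each round $\forall$ chooses a colour $c$, one of the graphs and a subset of its vertices; $\exists$ then chooses a subset of the other graph; $c$ is then assigned these two sets (erasing its previous use). The palette of a vertex is the set of colours whose set contains it; $P^G$ is the set of vertices of $G$ with palette exactly $P$ (similarly $P^H$). $\forall$ wins in round $n$ if at the beginning of that round (C1) some palette $P$ has $P^G$ empty and $P^H$ nonempty or vice versa, or (C2) there are palettes $P_1,P_2$ with an edge from $P_1^G$ to $P_2^G$ but none from $P_1^H$ to $P_2^H$, or vice versa. The strong Seurat game $\hat{\mathbf{G}}^k(G,H)$ is the same but $\forall$ also wins in round $n$ if at its beginning (C3) there are palettes $P_1,P_2$ such that every vertex of $P_2^G$ is the target of an edge from $P_1^G$ but some vertex of $P_2^H$ is not the target of any edge from $P_1^H$, or vice versa; or (C4) there are palettes $P_1,P_2$ such that every vertex of $P_1^G$ is the source of an edge into $P_2^G$ but some vertex of $P_1^H$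 is not the source of any edge into $P_2^H$, or vice versa. -}

module Defs where

open import Data.Nat using (ℕ; zero; suc)
open import Data.Bool using (Bool; true; false)
open import Data.Fin using (Fin)
open import Data.Fin.Subset using (Subset; _∈_) renaming (⊥ to ∅)
open import Data.Vec.Functional using (updateAt)
open import Data.Vec using (lookup; tabulate)
open import Data.Product using (Σ; _×_; _,_; ∃)
open import Data.Sum using (_⊎_)
open import Relation.Binary.PropositionalEquality using (_≡_; _≢_)

record Digraph : Set where
  field
    size : ℕ
    E    : Fin size → Fin size → Bool
open Digraph public

Colouring : ℕ → Digraph → Set
Colouring k G = Fin k → Subset (size G)

palette : ∀ {k} (G : Digraph) → Colouring k G → Fin (size G) → Subset k
palette G g v = tabulate (λ c → lookup (g c) v)

record Position (k : ℕ) (G H : Digraph) : Set where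
  constructor pos
  field
    gcol : Colouring k G
    hcol : Colouring k H
open Position public

initial : ∀ k G H → Position k G H
initial k G H = pos (λ _ → ∅) (λ _ → ∅)

-- One-sided winning conditions (for "P in G, Q in H");
-- the full conditions add "or vice versa".

C1₁ : ∀ {k} (G : Digraph) (g : Colouring k G) (H : Digraph) (h : Colouring k H) → Set
C1₁ {k} G g H h = Σ (Subset k) λ P →
  ((v : Fin (size G)) → palette G g v ≢ P) × (∃ λ w → palette H h w ≡ P)

C2₁ : ∀ {k} (G : Digraph) (g : Colouring k G) (H : Digraph) (h : Colouring k H) → Set
C2₁ {k} G g H h = Σ (Subset k) λ P₁ → Σ (Subset k) λ P₂ →
  (Σ (Fin (size G)) λ u → Σ (Fin (size G)) λ v →
     palette G g u ≡ P₁ × palette G g v ≡ P₂ × E G u v ≡ true)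
  × ((u v : Fin (size H)) → palette H h u ≡ P₁ → palette H h v ≡ P₂ → E H u v ≡ false)

C3₁ : ∀ {k} (G : Digraph) (g : Colouring k G) (H : Digraph) (h : Colouring k H) → Set
C3₁ {k} G g H h = Σ (Subset k) λ P₁ → Σ (Subset k) λ P₂ →
  ((v : Fin (size G)) → palette G g v ≡ P₂ →
     Σ (Fin (size G)) λ u → palette G g u ≡ P₁ × E G u v ≡ true)
  × (Σ (Fin (size H)) λ v → palette H h v ≡ P₂ ×
     ((u : Fin (size H)) → palette H h u ≡ P₁ → E H u v ≡ false))

C4₁ : ∀ {k} (G : Digraph) (g : Colouring k G) (H : Digraph) (h : Colouring k H) → Set
C4₁ {k} G g H h = Σ (Subset k) λ P₁ → Σ (Subset k) λ P₂ →
  ((u : Fin (size G)) → palette G g u ≡ P₁ →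
     Σ (Fin (size G)) λ v → palette G g v ≡ P₂ × E G u v ≡ true)
  × (Σ (Fin (size H)) λ u → palette H h u ≡ P₁ ×
     ((v : Fin (size H)) → palette H h v ≡ P₂ → E H u v ≡ false))

sym-cond : (∀ {k} (G : Digraph) (g : Colouring k G) (H : Digraph) (h : Colouring k H) → Set)
         → ∀ {k G H} → Position k G H → Set
sym-cond C {G = G} {H} (pos g h) = C G g H h ⊎ C H h G g

SeuratWin : ∀ {k G H} → Position k G H → Set
SeuratWin p = sym-cond C1₁ p ⊎ sym-cond C2₁ p

StrongSeuratWin : ∀ {k G H} → Position k G H → Set
StrongSeuratWin p = SeuratWin p ⊎ (sym-cond C3₁ p ⊎ sym-cond C4₁ p)

-- ∀ picks a colour c, a graph and a subset of it; ∃ answers with a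
-- subset of the other graph; c is reassigned to these two sets.
assignG : ∀ {k G H} → Position k G H → Fin k → Subset (size G) → Subset (size H) → Position k G H
assignG (pos g h) c X Y = pos (updateAt g c (λ _ → X)) (updateAt h c (λ _ → Y))

ForallWinsBy : ∀ {k G H} → (Position k G H → Set) → ℕ → Position k G H → Set
ForallWinsBy Win zero    p = Win p
ForallWinsBy {k} {G} {H} Win (suc n) p = Win p ⊎ Σ (Fin k) λ c →
     (Σ (Subset (size G)) λ X → (Y : Subset (size H)) → ForallWinsBy Win n (assignG p c X Y))
   ⊎ (Σ (Subset (size H)) λ Y → (X : Subset (size G)) → ForallWinsBy Win n (assignG p c X Y))

SeuratWinBy : (k : ℕ) (G H : Digraph) (n : ℕ) → Set
SeuratWinBy k G H n = ForallWinsBy SeuratWin n (initial k G H)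

StrongSeuratWinBy : (k : ℕ) (G H : Digraph) (n : ℕ) → Set
StrongSeuratWinBy k G H n = ForallWinsBy StrongSeuratWin n (initial k G H)

module Submission where

open import Defs
open import Data.Nat using (ℕ; zero; suc; _≤_; z≤n; s≤s)
open import Data.Bool using (true; false)
open import Data.Bool.Properties using () renaming (_≟_ to _≟ᵇ_)
open import Data.Fin using (Fin; zero; suc)
open import Data.Fin.Properties using (any?)
open import Data.Fin.Subset using (Subset; ⁅_⁆) renaming (⊥ to ∅)
open import Data.Fin.Subset.Properties using (x∈⁅x⁆; x∈⁅y⁆⇒x≡y)
open import Data.Vec using (_∷_; lookup)
open import Data.Vec.Properties
  using (∷-injectiveˡ; ∷-injectiveʳ; ≡-dec; tabulate-cong; lookup-replicate; []=⇒lookup; lookup⇒[]=)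
open import Data.Vec.Functional using (Vector; updateAt) renaming (_∷_ to _∷ᶠ_)
open import Data.Product using (_,_)
import Data.Sum as Sum
open import Data.Sum using (_⊎_; inj₁; inj₂)
open import Function using (id; const)
open import Function.Definitions using (Injective)
open import Relation.Nullary using (yes; no)
open import Relation.Binary.PropositionalEquality

-- ∀ plays the strong-game strategy with colours 1..k of the (k+1)-colour
-- game, keeping colour 0 empty, so that every palette P of the strong game
-- reappears as the shifted palette P without 0 (`Extension`). Conditions
-- (C1), (C2) transfer along this injective relabelling. If instead ∀ would
-- win by (C3), with every vertex of P₂ in G hit from P₁ but w ∈ P₂^H not
-- hit from P₁^H, he spends one extra round putting colour 0 on {w}: if ∃
-- answers with a set containing no vertex of P₂^G, the new palette
-- {0} ∪ P₂ violates (C1); otherwise an edge from P₁^G into that vertex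
-- violates (C2). (C4) is (C3) in the reversed digraphs.

updateAt-resp-≗ : ∀ {a} {A : Set a} {n} {xs ys : Vector A n} (i : Fin n) (f : A → A) →
  xs ≗ ys → updateAt xs i f ≗ updateAt ys i f
updateAt-resp-≗ zero    f eq zero    = cong f (eq zero)
updateAt-resp-≗ zero    f eq (suc j) = eq (suc j)
updateAt-resp-≗ (suc i) f eq zero    = eq zero
updateAt-resp-≗ (suc i) f eq (suc j) = updateAt-resp-≗ i f (λ j → eq (suc j)) j

updateAt-suc-∷ : ∀ {a} {A : Set a} {n} {xs : Vector A (suc n)} {x : A} {ys : Vector A n}
  (i : Fin n) (f : A → A) → xs ≗ x ∷ᶠ ys → updateAt xs (suc i) f ≗ x ∷ᶠ updateAt ys i f
updateAt-suc-∷ i f eq zero    = eq zero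
updateAt-suc-∷ i f eq (suc j) = updateAt-resp-≗ i f (λ j → eq (suc j)) j

updateAt-zero-∷ : ∀ {a} {A : Set a} {n} {xs : Vector A (suc n)} {x : A} {ys : Vector A n}
  (z : A) → xs ≗ x ∷ᶠ ys → updateAt xs zero (const z) ≗ z ∷ᶠ ys
updateAt-zero-∷ z eq zero    = refl
updateAt-zero-∷ z eq (suc j) = eq (suc j)

lookup-⁅x⁆-self : ∀ {n} (x : Fin n) → lookup ⁅ x ⁆ x ≡ true
lookup-⁅x⁆-self x = []=⇒lookup (x∈⁅x⁆ x)

lookup-⁅y⁆⇒≡ : ∀ {n} {x : Fin n} (y : Fin n) → lookup ⁅ y ⁆ x ≡ true → x ≡ y
lookup-⁅y⁆⇒≡ {x = x} y eq = x∈⁅y⁆⇒x≡y y (lookup⇒[]= x ⁅ y ⁆ eq)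

palette-cong : ∀ {k} (G : Digraph) {g g' : Colouring k G} → g ≗ g' →
  ∀ v → palette G g v ≡ palette G g' v
palette-cong G eq v = tabulate-cong (λ c → cong (λ S → lookup S v) (eq c))

record Relabelling {k k'} (f : Subset k → Subset k')
    (G : Digraph) (g : Colouring k G) (g' : Colouring k' G) : Set where
  constructor relabelling
  field relabels : ∀ v → palette G g' v ≡ f (palette G g v)
open Relabelling

SeuratWin₁ : ∀ {k} (G : Digraph) → Colouring k G → (H : Digraph) → Colouring k H → Set
SeuratWin₁ G g H h = C1₁ G g H h ⊎ C2₁ G g H h

module _ {k k'} {f : Subset k → Subset k'} (f-injective : Injective _≡_ _≡_ f)
         {G H : Digraph} {g : Colouring k G} {g' : Colouring k' G}
         {h : Colouring k H} {h' : Colouring k' H}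
         (rg : Relabelling f G g g') (rh : Relabelling f H h h') where

  private
    unrelabel : ∀ {K : Digraph} {c : Colouring k K} {c'} → Relabelling f K c c' →
      ∀ {v P} → palette K c' v ≡ f P → palette K c v ≡ P
    unrelabel r {v} eq = f-injective (trans (sym (relabels r v)) eq)

  C1₁-relabel : C1₁ G g H h → C1₁ G g' H h'
  C1₁-relabel (P , absent , (w , pw)) =
    f P , (λ v pv → absent v (unrelabel rg pv)) , (w , trans (relabels rh w) (cong f pw))

  C2₁-relabel : C2₁ G g H h → C2₁ G g' H h'
  C2₁-relabel (P₁ , P₂ , (u , v , pu , pv , uv) , noEdge) =
    f P₁ , f P₂ ,
    (u , v , trans (relabels rg u) (cong f pu) , trans (relabels rg v) (cong f pv) , uv) ,
    λ u' v' pu' pv' → noEdge u' v' (unrelabel rh pu') (unrelabel rh pv')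

seuratWin-relabel : ∀ {k k'} {G H} {f : Subset k → Subset k'} → Injective _≡_ _≡_ f →
  {g : Colouring k G} {g' : Colouring k' G} {h : Colouring k H} {h' : Colouring k' H} →
  Relabelling f G g g' → Relabelling f H h h' → SeuratWin (pos g h) → SeuratWin (pos g' h')
seuratWin-relabel f-inj rg rh =
  Sum.map (Sum.map (C1₁-relabel f-inj rg rh) (C1₁-relabel f-inj rh rg))
          (Sum.map (C2₁-relabel f-inj rg rh) (C2₁-relabel f-inj rh rg))

seuratWin-cong : ∀ {k G H} {g g' : Colouring k G} {h h' : Colouring k H} →
  g' ≗ g → h' ≗ h → SeuratWin (pos g h) → SeuratWin (pos g' h')
seuratWin-cong {G = G} {H} {g} {g'} {h} {h'} eg eh =
  seuratWin-relabel {G = G} {H} {f = id} id {g} {g'} {h} {h'}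
    (relabelling (palette-cong G eg)) (relabelling (palette-cong H eh))

record PebbleWin {k} (G : Digraph) (g : Colouring k G) (H : Digraph) (h : Colouring k H) : Set where
  constructor pebbleAt
  field
    target : Fin (size H)
    wins   : ∀ X → SeuratWin₁ G (X ∷ᶠ g) H (⁅ target ⁆ ∷ᶠ h)

C3₁⇒pebbleWin : ∀ {k G H} {g : Colouring k G} {h : Colouring k H} →
  C3₁ G g H h → PebbleWin G g H h
C3₁⇒pebbleWin {G = G} {H} {g} {h} (P₁ , P₂ , covered , (w , pw , uncovered)) = pebbleAt w win
  where
  win : ∀ X → SeuratWin₁ G (X ∷ᶠ g) H (⁅ w ⁆ ∷ᶠ h)
  win X with any? (λ v → ≡-dec _≟ᵇ_ (palette G (X ∷ᶠ g) v) (true ∷ P₂))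
  ... | no absent = inj₁ (true ∷ P₂ , (λ v pv → absent (v , pv)) ,
                         (w , cong₂ _∷_ (lookup-⁅x⁆-self w) pw))
  ... | yes (v , pv) with covered v (∷-injectiveʳ pv)
  ...   | u , pu , uv = inj₂ (palette G (X ∷ᶠ g) u , true ∷ P₂ , (u , v , refl , pv , uv) , noEdge)
    where
    noEdge : ∀ u' v' → palette H (⁅ w ⁆ ∷ᶠ h) u' ≡ palette G (X ∷ᶠ g) u →
      palette H (⁅ w ⁆ ∷ᶠ h) v' ≡ true ∷ P₂ → E H u' v' ≡ false
    noEdge u' v' pu' pv' rewrite lookup-⁅y⁆⇒≡ w (∷-injectiveˡ pv') =
      uncovered u' (trans (∷-injectiveʳ pu') pu)

reverse : Digraph → Digraph
reverse G = record { size = size G ; E = λ u v → E G v u }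

C4₁⇒C3₁-reverse : ∀ {k G H} {g : Colouring k G} {h : Colouring k H} →
  C4₁ G g H h → C3₁ (reverse G) g (reverse H) h
C4₁⇒C3₁-reverse (P₁ , P₂ , covering , uncovering) = P₂ , P₁ , covering , uncovering

C2₁-unreverse : ∀ {k G H} {g : Colouring k G} {h : Colouring k H} →
  C2₁ (reverse G) g (reverse H) h → C2₁ G g H h
C2₁-unreverse (P₁ , P₂ , (u , v , pu , pv , uv) , noEdge) =
  P₂ , P₁ , (v , u , pv , pu , uv) , λ u' v' pu' pv' → noEdge v' u' pv' pu'

C4₁⇒pebbleWin : ∀ {k G H} {g : Colouring k G} {h : Colouring k H} →
  C4₁ G g H h → PebbleWin G g H h
C4₁⇒pebbleWin {G = G} {H} {g} {h} c
  with C3₁⇒pebbleWin {G = reverse G} {reverse H} {g} {h} (C4₁⇒C3₁-reverse {G = G} {H} {g} {h} c)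
... | pebbleAt w win =
  pebbleAt w λ X → Sum.map id (C2₁-unreverse {G = G} {H} {X ∷ᶠ g} {⁅ w ⁆ ∷ᶠ h}) (win X)

record Extension {k G H} (p : Position k G H) (q : Position (suc k) G H) : Set where
  constructor _,_
  field
    extendsᴳ : gcol q ≗ ∅ ∷ᶠ gcol p
    extendsᴴ : hcol q ≗ ∅ ∷ᶠ hcol p

extension-initial : ∀ k G H → Extension (initial k G H) (initial (suc k) G H)
extension-initial k G H = empty , empty
  where
  empty : ∀ {m} → (λ (_ : Fin (suc k)) → ∅ {m}) ≗ ∅ ∷ᶠ (λ _ → ∅)
  empty zero    = refl
  empty (suc c) = refl

extension-assign : ∀ {k G H} {p : Position k G H} {q} → Extension p q →
  ∀ c X Y → Extension (assignG p c X Y) (assignG q (suc c) X Y)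
extension-assign (eg , eh) c X Y = updateAt-suc-∷ c (const X) eg , updateAt-suc-∷ c (const Y) eh

extension-relabels : ∀ {k} (G : Digraph) {g : Colouring k G} {g'} →
  g' ≗ ∅ ∷ᶠ g → Relabelling (false ∷_) G g g'
extension-relabels G {g} eq = relabelling λ v →
  trans (palette-cong G eq v) (cong (_∷ palette G g v) (lookup-replicate v false))

seuratWin-extend : ∀ {k G H} {p : Position k G H} {q} → Extension p q → SeuratWin p → SeuratWin q
seuratWin-extend {G = G} {H} (eg , eh) =
  seuratWin-relabel ∷-injectiveʳ (extension-relabels G eg) (extension-relabels H eh)

pebbleInH : ∀ {k G H} {p : Position k G H} {q} → Extension p q →
  PebbleWin G (gcol p) H (hcol p) → ForallWinsBy SeuratWin 1 q
pebbleInH {G = G} {H} {p = pos g h} (eg , eh) (pebbleAt w win) =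
  inj₂ (zero , inj₂ (⁅ w ⁆ , λ X →
    seuratWin-cong {G = G} {H} (updateAt-zero-∷ {ys = g} X eg) (updateAt-zero-∷ {ys = h} ⁅ w ⁆ eh)
      (Sum.map inj₁ inj₁ (win X))))

pebbleInG : ∀ {k G H} {p : Position k G H} {q} → Extension p q →
  PebbleWin H (hcol p) G (gcol p) → ForallWinsBy SeuratWin 1 q
pebbleInG {G = G} {H} {p = pos g h} (eg , eh) (pebbleAt w win) =
  inj₂ (zero , inj₁ (⁅ w ⁆ , λ Y →
    seuratWin-cong {G = G} {H} (updateAt-zero-∷ {ys = g} ⁅ w ⁆ eg) (updateAt-zero-∷ {ys = h} Y eh)
      (Sum.map inj₂ inj₂ (win Y))))

strongSeuratWin-extend : ∀ {k G H} {p : Position k G H} {q} → Extension p q →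
  StrongSeuratWin p → ForallWinsBy SeuratWin 1 q
strongSeuratWin-extend e (inj₁ win)              = inj₁ (seuratWin-extend e win)
strongSeuratWin-extend e (inj₂ (inj₁ (inj₁ c3))) = pebbleInH e (C3₁⇒pebbleWin c3)
strongSeuratWin-extend e (inj₂ (inj₁ (inj₂ c3))) = pebbleInG e (C3₁⇒pebbleWin c3)
strongSeuratWin-extend e (inj₂ (inj₂ (inj₁ c4))) = pebbleInH e (C4₁⇒pebbleWin c4)
strongSeuratWin-extend e (inj₂ (inj₂ (inj₂ c4))) = pebbleInG e (C4₁⇒pebbleWin c4)

forallWinsBy-mono : ∀ {k G H} (W : Position k G H → Set) {m n} → m ≤ n →
  ∀ {p} → ForallWinsBy W m p → ForallWinsBy W n p
forallWinsBy-mono W {n = zero}  z≤n win = win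
forallWinsBy-mono W {n = suc n} z≤n win = inj₁ win
forallWinsBy-mono W (s≤s m≤n) (inj₁ win) = inj₁ win
forallWinsBy-mono W (s≤s m≤n) (inj₂ (c , inj₁ (X , σ))) =
  inj₂ (c , inj₁ (X , λ Y → forallWinsBy-mono W m≤n (σ Y)))
forallWinsBy-mono W (s≤s m≤n) (inj₂ (c , inj₂ (Y , σ))) =
  inj₂ (c , inj₂ (Y , λ X → forallWinsBy-mono W m≤n (σ X)))

strongSeuratWinsBy-extend : ∀ {k G H} n {p : Position k G H} {q} → Extension p q →
  ForallWinsBy StrongSeuratWin n p → ForallWinsBy SeuratWin (suc n) q
strongSeuratWinsBy-extend zero    e win        = strongSeuratWin-extend e win
strongSeuratWinsBy-extend (suc n) e (inj₁ win) =
  forallWinsBy-mono SeuratWin {n = suc (suc n)} (s≤s z≤n) (strongSeuratWin-extend e win)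
strongSeuratWinsBy-extend (suc n) e (inj₂ (c , inj₁ (X , σ))) =
  inj₂ (suc c , inj₁ (X , λ Y → strongSeuratWinsBy-extend n (extension-assign e c X Y) (σ Y)))
strongSeuratWinsBy-extend (suc n) e (inj₂ (c , inj₂ (Y , σ))) =
  inj₂ (suc c , inj₂ (Y , λ X → strongSeuratWinsBy-extend n (extension-assign e c X Y) (σ X)))

lemma3p1 : (G H : Digraph) (k : ℕ) → 1 ≤ k → (n : ℕ) →
    StrongSeuratWinBy k G H n → SeuratWinBy (suc k) G H (suc n)
lemma3p1 G H k _ n = strongSeuratWinsBy-extend n (extension-initial k G H)
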